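{- Let $g\ge4$ be an even integer. The only primitive number $m$ with $o_g(m)=1$ is $m=g-1$. There are no primitive numbers $m$ with $o_g(m)=2$ or $o_g(m)=3$. If $g-1$ is not divisible by $3$, there are no primitive numbers $m$ with $o_g(m)=4$ or $o_g(m)=5$. If $g-1$ is divisible by $3$, then there is exactly one primitive number of order $4$, namely $\frac{g^4-1}{3}$, and exactly one primitive number of order $5$, namely $\frac{g^5-1}{3}$.
   Context: Fix an even integer $g\ge4$. For an odd integer $m\ge1$, an extreme cycle for the digit set $\{0,m\}$ is a finite set of distinct integers $\{x_0,\dots,x_{r-1}\}$ together with digits $l_0,\dots,l_{r-1}\in\{0,m\}$ such that $x_{j+1}=(x_j+l_j)/g$ for $0\le j\le r-2$ and $x_0=(x_{r-1}+l_{r-1})/g$. The cycle $\{0\}$ (with digit $0$) is the trivial extreme cycle. The odd number $m$ is complete if the only extreme cycle for $\{0,m\}$ is the trivial one, and incomplete otherwise. An odd number $m$ is primitive if it is incomplete and every proper divisor of $m$ is complete (primitive numbers are coprime to $g$). For $m$ coprime to $g$, $o_g(m)$ (the order of $m$) denotes the order of $g$ in the multiplicative group $U(\mathbb{Z}_m)$. -}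

module Defs where

open import Data.Nat as ℕ using (ℕ; zero; suc; _^_; _∸_; _≤_; _<_)
open import Data.Nat.Divisibility using (_∣_)
open import Data.Integer as ℤ using (ℤ; +_)
open import Data.Fin using (Fin; inject₁; fromℕ)
import Data.Fin as F
open import Data.Product using (Σ; ∃; _×_)
open import Data.Sum using (_⊎_)
open import Relation.Nullary using (¬_)
open import Relation.Binary.PropositionalEquality using (_≡_; _≢_)
open import Function.Definitions using (Injective)

-- An extreme cycle of length r = suc n for the digit set {0, m} in base g:
-- distinct integers x₀,…,x_{r-1} and digits l_j ∈ {0,m} with
-- g·x_{j+1} = x_j + l_j (0 ≤ j ≤ r-2) and g·x₀ = x_{r-1} + l_{r-1}.
record ExtremeCycle (g m : ℕ) (n : ℕ) : Set where
  field
    x        : Fin (suc n) → ℤ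
    l        : Fin (suc n) → ℤ
    distinct : Injective _≡_ _≡_ x
    digits   : ∀ j → (l j ≡ + 0) ⊎ (l j ≡ + m)
    step     : ∀ (j : Fin n) →
               (+ g) ℤ.* x (F.suc j) ≡ x (inject₁ j) ℤ.+ l (inject₁ j)
    close    : (+ g) ℤ.* x F.zero ≡ x (fromℕ n) ℤ.+ l (fromℕ n)

-- The cycle is trivial iff its set of elements is {0}; since the set is
-- nonempty, it is nontrivial iff some element is nonzero.
NontrivialCycle : ∀ {g m n} → ExtremeCycle g m n → Set
NontrivialCycle c = ∃ λ j → ExtremeCycle.x c j ≢ + 0

Odd : ℕ → Set
Odd m = ¬ (2 ∣ m)

Incomplete : ℕ → ℕ → Set
Incomplete g m = Σ ℕ λ n → Σ (ExtremeCycle g m n) NontrivialCycle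

Complete : ℕ → ℕ → Set
Complete g m = ¬ Incomplete g m

Primitive : ℕ → ℕ → Set
Primitive g m = Odd m × Incomplete g m × (∀ d → d ∣ m → d ≢ m → Complete g d)

IsOrder : ℕ → ℕ → ℕ → Set
IsOrder g m k = 1 ≤ k × m ∣ (g ^ k ∸ 1) × (∀ j → 1 ≤ j → j < k → ¬ (m ∣ (g ^ j ∸ 1)))

module Submission where

-- A nontrivial extreme cycle consists of natural numbers x_j < m with
-- g·x_j = x_(j-1) + l_(j-1), l ∈ {0, m}.  Summing the relation gives
-- D·Σx = w·m, where the weight w counts the digits equal to m; unrolling it
-- around the cycle of length r gives (g^r - 1)·x_0 = m·N, where N is the value
-- of the digit word read in base g.  If m ∣ g^k - 1 the cycle closes after k
-- steps, so r ≤ k and 1 ≤ w < k.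
--   * Order 1: every incomplete m is ≥ D, and D is incomplete (the cycle {1}).
--   * Orders 2..5: a primitive m of order k ≥ 2 is not a multiple of D, while
--     D ∣ w·m with w ≤ 4 and D odd; this forces w = 3 (so k ≥ 4) and 3 ∣ D.
--   * Then r = k and, writing g^k - 1 = q·m, q divides the value of a weight-3
--     word of length k.  Each such word rotates to 1110, 11100 or 11010, and in
--     each case q ∣ 3, so m is (g^k - 1)/3 or the multiple g^k - 1 of D.
--     Explicit cycles show that (g^k - 1)/3 is incomplete; the same argument
--     shows that its proper divisors are complete.

open import Defs
open import Data.Bool using (Bool; true; false)
open import Data.Nat as ℕ
  using (ℕ; zero; suc; _+_; _*_; _^_; _∸_; _≤_; _<_; z≤n; s≤s; NonZero)
open import Data.Nat.Properties as ℕ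
open import Data.Nat.Divisibility
  using (_∣_; divides; ∣m+n∣m⇒∣n; ∣n⇒∣m*n; ∣m⇒∣m*n; ∣⇒≤; ∣-trans; 0∣⇒≡0; ∣1⇒≡1;
         n∣m⇒m%n≡0; *-cancelˡ-∣)
open import Data.Nat.Coprimality using (Coprime; coprime-divisor)
open import Data.Nat.DivMod using (_%_; _/_; [m+kn]%n≡m%n; m<n⇒m%n≡m; m*n/n≡m)
open import Data.Nat.Tactic.RingSolver using (solve-∀)
open import Data.Integer as ℤ using (ℤ; -[1+_]) renaming (+_ to pos)
import Data.Integer.Properties as ℤ
open import Data.Fin using (Fin; zero; suc; inject₁; fromℕ; toℕ)
open import Data.Fin.Properties using (toℕ-fromℕ; toℕ-inject₁; toℕ-injective)
open import Data.List using (allFin)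
open import Data.List.Membership.Propositional.Properties using (∈-allFin)
import Data.List.Relation.Unary.All as All
import Data.List.Extrema
open import Data.Vec as Vec using (Vec; []; _∷_; _∷ʳ_)
open import Data.Product using (Σ; ∃; _×_; _,_; proj₁; proj₂)
open import Data.Sum using (_⊎_; inj₁; inj₂; [_,_]′)
open import Data.Empty using (⊥)
open import Function using (_∘_; id)
open import Function.Definitions using (Injective)
open import Relation.Nullary using (¬_; contradiction; yes; no)
open import Relation.Binary.PropositionalEquality
open import Algebra.Properties.Semiring.Sum ℕ.+-*-semiring
  using (sum; sum-cong-≗; ∑-distrib-+; *-distribˡ-sum; *-distribʳ-sum; sum-init-last)

unpred : ∀ {P X} → 1 ≤ P → P ∸ 1 ≡ X → P ≡ suc X
unpred 1≤P P∸1≡X = trans (sym (m+[n∸m]≡n 1≤P)) (cong suc P∸1≡X)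

∣-rest : ∀ {q X Y Z} → X ≡ Y + Z → q ∣ X → q ∣ Y → q ∣ Z
∣-rest X≡Y+Z q∣X q∣Y = ∣m+n∣m⇒∣n (subst (_ ∣_) X≡Y+Z q∣X) q∣Y

same-residue : ∀ {a b m} u v → a < m → b < m → a + u * m ≡ b + v * m → a ≡ b
same-residue {a} {b} {m} u v a<m b<m e = begin
  a                 ≡⟨ sym (m<n⇒m%n≡m a<m) ⟩
  a % m             ≡⟨ sym ([m+kn]%n≡m%n a u m) ⟩
  (a + u * m) % m   ≡⟨ cong (_% m) e ⟩
  (b + v * m) % m   ≡⟨ [m+kn]%n≡m%n b v m ⟩
  b % m             ≡⟨ m<n⇒m%n≡m b<m ⟩
  b                 ∎
  where
  open ≡-Reasoning
  instance
    m≢0 : NonZero m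
    m≢0 = ℕ.>-nonZero (≤-trans (s≤s z≤n) a<m)

one-of-two : ∀ {a b} → b ≤ a → a ≤ suc b → a ≡ b ⊎ a ≡ suc b
one-of-two b≤a a≤1+b with m≤n⇒m<n∨m≡n b≤a
... | inj₁ b<a = inj₂ (≤-antisym a≤1+b b<a)
... | inj₂ b≡a = inj₁ (sym b≡a)

three-divides : ∀ {w} → 1 ≤ w → w ≤ 4 → 3 ∣ w → w ≡ 3
three-divides {1} _ _ 3∣w = contradiction (n∣m⇒m%n≡0 1 3 3∣w) λ ()
three-divides {2} _ _ 3∣w = contradiction (n∣m⇒m%n≡0 2 3 3∣w) λ ()
three-divides {3} _ _ _ = refl
three-divides {4} _ _ 3∣w = contradiction (n∣m⇒m%n≡0 4 3 3∣w) λ ()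
three-divides {suc (suc (suc (suc (suc _))))} _ (s≤s (s≤s (s≤s (s≤s ())))) _

divisors-of-3 : ∀ {q} → q ∣ 3 → q ≡ 1 ⊎ q ≡ 3
divisors-of-3 {0} 0∣3 = contradiction (0∣⇒≡0 0∣3) λ ()
divisors-of-3 {1} _ = inj₁ refl
divisors-of-3 {2} 2∣3 = contradiction (n∣m⇒m%n≡0 3 2 2∣3) λ ()
divisors-of-3 {3} _ = inj₂ refl
divisors-of-3 {suc (suc (suc (suc _)))} q∣3 with ∣⇒≤ q∣3
... | s≤s (s≤s (s≤s ()))

-- An odd D is coprime to each 1 ≤ w ≤ 4, except possibly to w = 3, so it
-- cancels from D ∣ w·m.
cancel-weight : ∀ {D w m} → ¬ 2 ∣ D → 1 ≤ w → w ≤ 4 → (w ≡ 3 → ¬ 3 ∣ D) → D ∣ w * m → D ∣ m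
cancel-weight {D} {w} odd 1≤w w≤4 w≡3⇒3∤D = coprime-divisor coprime
  where
  common : ∀ c → c ∣ D → c ∣ w → c ≤ 4 → c ≡ 1
  common 0 _ 0∣w _ = contradiction (subst (1 ≤_) (0∣⇒≡0 0∣w) 1≤w) λ ()
  common 1 _ _ _ = refl
  common 2 2∣D _ _ = contradiction 2∣D odd
  common 3 3∣D 3∣w _ = contradiction 3∣D (w≡3⇒3∤D (three-divides 1≤w w≤4 3∣w))
  common 4 4∣D _ _ = contradiction (∣-trans (divides 2 refl) 4∣D) odd
  common (suc (suc (suc (suc (suc _))))) _ _ (s≤s (s≤s (s≤s (s≤s ()))))
  coprime : Coprime D w
  coprime {c} (c∣D , c∣w) = common c c∣D c∣w (≤-trans (∣⇒≤ {{ℕ.>-nonZero 1≤w}} c∣w) w≤4)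

not-three-divides : ∀ {X} a r → X ≡ 3 * a + r → ¬ 3 ∣ r → ¬ 3 ∣ X
not-three-divides a r X≡ 3∤r 3∣X = 3∤r (∣-rest X≡ 3∣X (∣m⇒∣m*n a (divides 1 refl)))

-- Cyclic indexing.  A cycle of length suc n is indexed by Fin (suc n); the
-- defining relation expresses element j in terms of element prev j.

prev : ∀ {n} → Fin (suc n) → Fin (suc n)
prev {n} zero = fromℕ n
prev (suc j) = inject₁ j

prev^ : ∀ {n} → ℕ → Fin (suc n) → Fin (suc n)
prev^ zero j = j
prev^ (suc t) j = prev (prev^ t j)

prev-lowers : ∀ {n} (p : Fin (suc n)) → toℕ p ≢ 0 → suc (toℕ (prev p)) ≡ toℕ p
prev-lowers zero p≢0 = contradiction refl p≢0
prev-lowers (suc p) _ = cong suc (toℕ-inject₁ p)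

prev^-zero : ∀ {n} t → t ≤ n → toℕ (prev^ {n} (suc t) zero) + t ≡ n
prev^-zero {n} zero _ = trans (+-identityʳ _) (toℕ-fromℕ n)
prev^-zero {n} (suc t) t<n = begin
  toℕ (prev p) + suc t   ≡⟨ +-suc (toℕ (prev p)) t ⟩
  suc (toℕ (prev p)) + t ≡⟨ cong (_+ t) (prev-lowers p p≢0) ⟩
  toℕ p + t              ≡⟨ ih ⟩
  n                      ∎
  where
  open ≡-Reasoning
  p = prev^ (suc t) zero
  ih = prev^-zero t (≤-trans (n≤1+n t) t<n)
  p≢0 : toℕ p ≢ 0
  p≢0 p≡0 = <-irrefl (sym (trans (sym ih) (cong (_+ t) p≡0))) t<n

full-turn : ∀ {n} → prev^ {n} (suc n) zero ≡ zero
full-turn {n} = toℕ-injective (+-cancelʳ-≡ n _ 0 (prev^-zero n ≤-refl))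

first-return : ∀ {n} k → 1 ≤ k → prev^ {n} k zero ≡ zero → suc n ≤ k
first-return {n} (suc t) _ returns with ≤-total n t
... | inj₁ n≤t = s≤s n≤t
... | inj₂ t≤n = s≤s (≤-reflexive (trans (sym (prev^-zero t t≤n)) (cong (λ p → toℕ p + t) returns)))

sum-prev : ∀ {n} (f : Fin (suc n) → ℕ) → sum (f ∘ prev) ≡ sum f
sum-prev {n} f = trans (+-comm (f (fromℕ n)) (sum (f ∘ inject₁))) (sym (sum-init-last f))

sum-const : ∀ n c → sum {n} (λ _ → c) ≡ n * c
sum-const zero c = refl
sum-const (suc n) c = cong (c +_) (sum-const n c)

term-≤-sum : ∀ {n} (f : Fin n → ℕ) i → f i ≤ sum f
term-≤-sum f zero = m≤m+n _ _
term-≤-sum f (suc i) = ≤-trans (term-≤-sum (f ∘ suc) i) (m≤n+m _ _)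

sum-mono : ∀ {n} (f h : Fin n → ℕ) → (∀ i → f i ≤ h i) → sum f ≤ sum h
sum-mono {zero} f h _ = z≤n
sum-mono {suc n} f h f≤h = +-mono-≤ (f≤h zero) (sum-mono (f ∘ suc) (h ∘ suc) (f≤h ∘ suc))

sum-mono-equal : ∀ {n} (f h : Fin n → ℕ) → (∀ i → f i ≤ h i) → sum f ≡ sum h → ∀ i → f i ≡ h i
sum-mono-equal f h f≤h same i = ≤-antisym (f≤h i) (≮⇒≥ strict)
  where
  strict : ¬ f i < h i
  strict fi<hi = <-irrefl same (sum-mono-< f h f≤h i fi<hi)
    where
    sum-mono-< : ∀ {n} (f h : Fin n → ℕ) → (∀ i → f i ≤ h i) → ∀ i → f i < h i → sum f < sum h
    sum-mono-< f h f≤h zero lt = +-mono-<-≤ lt (sum-mono (f ∘ suc) (h ∘ suc) (f≤h ∘ suc))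
    sum-mono-< f h f≤h (suc i) lt =
      +-mono-≤-< (f≤h zero) (sum-mono-< (f ∘ suc) (h ∘ suc) (f≤h ∘ suc) i lt)

minimal-index : ∀ {n} (f : Fin (suc n) → ℤ) → ∃ λ j → ∀ i → f j ℤ.≤ f i
minimal-index {n} f =
  argmin f zero (allFin (suc n)) ,
  λ i → All.lookup (f[argmin]≤f[xs] {f = f} zero (allFin (suc n))) (∈-allFin i)
  where open Data.List.Extrema ℤ.≤-totalOrder

maximal-index : ∀ {n} (f : Fin (suc n) → ℕ) → ∃ λ j → ∀ i → f i ≤ f j
maximal-index {n} f =
  argmax f zero (allFin (suc n)) ,
  λ i → All.lookup (f[xs]≤f[argmax] {f = f} zero (allFin (suc n))) (∈-allFin i)
  where open Data.List.Extrema ℕ.≤-totalOrder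

-- Bit words.  The digits of a cycle are recorded as bits (true for the digit m);
-- a word is read as a base-g numeral, least significant digit first.

bit : Bool → ℕ
bit false = 0
bit true = 1

ones : ∀ {n} → Vec Bool n → ℕ
ones bs = Vec.sum (Vec.map bit bs)

val : ∀ {n} → ℕ → Vec Bool n → ℕ
val g [] = 0
val g (b ∷ bs) = bit b + g * val g bs

rotate : ∀ {n} → Vec Bool (suc n) → Vec Bool (suc n)
rotate (b ∷ bs) = bs ∷ʳ b

val-∷ʳ : ∀ g {n} (bs : Vec Bool n) b → val g (bs ∷ʳ b) ≡ val g bs + g ^ n * bit b
val-∷ʳ g [] b = ring (bit b) g
  where
  ring : ∀ c g → c + g * 0 ≡ 0 + (1 * c)
  ring = solve-∀
val-∷ʳ g {suc n} (c ∷ bs) b = begin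
  bit c + g * val g (bs ∷ʳ b)              ≡⟨ cong (λ v → bit c + g * v) (val-∷ʳ g bs b) ⟩
  bit c + g * (val g bs + g ^ n * bit b)   ≡⟨ ring (bit c) g (val g bs) (g ^ n) (bit b) ⟩
  bit c + g * val g bs + g * g ^ n * bit b ∎
  where
  open ≡-Reasoning
  ring : ∀ c g v p b → c + g * (v + p * b) ≡ c + g * v + g * p * b
  ring = solve-∀

-- Rotation multiplies the value by g^n, the inverse of g, modulo g^(n+1) - 1:
-- g^n·val(b ∷ bs) ≡ val(rotate (b ∷ bs)) + (g^(n+1) - 1)·val bs.
rotate-val : ∀ g {n} b (bs : Vec Bool n) →
             g ^ n * val g (b ∷ bs) + val g bs ≡ val g (rotate (b ∷ bs)) + g ^ suc n * val g bs
rotate-val g {n} b bs = begin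
  g ^ n * (bit b + g * val g bs) + val g bs         ≡⟨ ring (g ^ n) (bit b) g (val g bs) ⟩
  (val g bs + g ^ n * bit b) + g * g ^ n * val g bs ≡⟨ cong (_+ g * g ^ n * val g bs)
                                                            (sym (val-∷ʳ g bs b)) ⟩
  val g (bs ∷ʳ b) + g * g ^ n * val g bs            ∎
  where
  open ≡-Reasoning
  ring : ∀ p c g v → p * (c + g * v) + v ≡ (v + p * c) + g * p * v
  ring = solve-∀

rotate-∣ : ∀ {g q n} → 1 ≤ g → q ∣ g ^ suc n ∸ 1 → (bs : Vec Bool (suc n)) →
           q ∣ val g bs → q ∣ val g (rotate bs)
rotate-∣ {g} {q} {n} 1≤g (divides c P∸1≡cq) (b ∷ bs) q∣V =
  ∣m+n∣m⇒∣n (subst (q ∣_) split q∣g^nV) (divides (c * val g bs) refl)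
  where
  R = val g (rotate (b ∷ bs))
  V = val g bs
  q∣g^nV : q ∣ g ^ n * val g (b ∷ bs)
  q∣g^nV = ∣n⇒∣m*n (g ^ n) q∣V
  split : g ^ n * val g (b ∷ bs) ≡ c * V * q + R
  split = +-cancelʳ-≡ V _ _ (begin
    g ^ n * val g (b ∷ bs) + V      ≡⟨ rotate-val g b bs ⟩
    R + g ^ suc n * V               ≡⟨ cong (λ P → R + P * V) (unpred (m^n>0 g (suc n)) P∸1≡cq) ⟩
    R + suc (c * q) * V             ≡⟨ ring R c q V ⟩
    c * V * q + R + V               ∎)
    where
    open ≡-Reasoning
    instance
      g≢0 : NonZero g
      g≢0 = ℕ.>-nonZero 1≤g
    ring : ∀ R c q V → R + (1 + c * q) * V ≡ c * V * q + R + V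
    ring = solve-∀

rotate^ : ∀ {n} → ℕ → Vec Bool (suc n) → Vec Bool (suc n)
rotate^ zero bs = bs
rotate^ (suc k) bs = rotate (rotate^ k bs)

rotate^-∣ : ∀ {g q n} → 1 ≤ g → q ∣ g ^ suc n ∸ 1 → ∀ k {bs cs : Vec Bool (suc n)} →
            rotate^ k bs ≡ cs → q ∣ val g bs → q ∣ val g cs
rotate^-∣ 1≤g q∣P zero refl q∣V = q∣V
rotate^-∣ 1≤g q∣P (suc k) {bs} refl q∣V =
  rotate-∣ 1≤g q∣P (rotate^ k bs) (rotate^-∣ 1≤g q∣P k refl q∣V)

-- Cycles over ℕ: distinct x_j with g·x_j = x_(prev j) + l_(prev j), where the
-- digit l_j ∈ {0, m} is recorded by the bit d_j (l_j = bit d_j · m).  In base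
-- g ≥ 2 these are exactly the nontrivial extreme cycles of Defs.
record Cycle (g m n : ℕ) : Set where
  field
    x        : Fin (suc n) → ℕ
    d        : Fin (suc n) → Bool
    distinct : Injective _≡_ _≡_ x
    step     : ∀ j → g * x j ≡ x (prev j) + bit (d (prev j)) * m
    nonzero  : ∃ λ j → x j ≢ 0

pos-step : ∀ g a b c → g * a ≡ b + c → pos g ℤ.* pos a ≡ pos b ℤ.+ pos c
pos-step g a b c e = trans (sym (ℤ.pos-* g a)) (trans (cong pos e) (ℤ.pos-+ b c))

cycle⇒incomplete : ∀ {g m n} → Cycle g m n → Incomplete g m
cycle⇒incomplete {g} {m} {n} C = n , extreme , proj₁ nonzero , proj₂ nonzero ∘ ℤ.+-injective
  where
  open Cycle C
  digit : ∀ j → (pos (bit (d j) * m) ≡ pos 0) ⊎ (pos (bit (d j) * m) ≡ pos m)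
  digit j with d j
  ... | false = inj₁ refl
  ... | true = inj₂ (cong pos (*-identityˡ m))
  step-ℤ : ∀ j → pos g ℤ.* pos (x j) ≡ pos (x (prev j)) ℤ.+ pos (bit (d (prev j)) * m)
  step-ℤ j = pos-step g (x j) (x (prev j)) (bit (d (prev j)) * m) (step j)
  extreme : ExtremeCycle g m n
  extreme = record
    { x = pos ∘ x
    ; l = λ j → pos (bit (d j) * m)
    ; distinct = distinct ∘ ℤ.+-injective
    ; digits = digit
    ; step = λ j → step-ℤ (suc j)
    ; close = step-ℤ zero
    }

-- In base g ≥ 2, a nonnegative digit makes every element of an extreme cycle
-- nonnegative: the least element a satisfies a ≤ g·a, impossible for a < 0.
nonneg-if-below-multiple : ∀ {g} → 2 ≤ g → ∀ a → a ℤ.≤ pos g ℤ.* a → pos 0 ℤ.≤ a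
nonneg-if-below-multiple _ (pos k) _ = ℤ.+≤+ z≤n
nonneg-if-below-multiple {suc (suc h)} (s≤s (s≤s z≤n)) -[1+ k ] (ℤ.-≤- k+h′≤k) =
  contradiction k+h′≤k (<⇒≱ (m<m+n k (s≤s z≤n)))

-- Conversely, a nontrivial extreme cycle in base g ≥ 2 is an ℕ-cycle: its least
-- element is nonnegative, hence so are all its elements.
incomplete⇒cycle : ∀ {g m} → 2 ≤ g → Incomplete g m → ∃ (Cycle g m)
incomplete⇒cycle {g} {m} 2≤g (n , c , j≢0 , xj≢0) = n , record
  { x = xℕ
  ; d = bits
  ; distinct = λ {i} {j} e → distinct (trans (sym (xℕ-pos i)) (trans (cong pos e) (xℕ-pos j)))
  ; step = λ j → ℤ.+-injective (stepℕ j)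
  ; nonzero = j≢0 , λ e → xj≢0 (trans (sym (xℕ-pos j≢0)) (cong pos e))
  }
  where
  open ExtremeCycle c
  step-cyclic : ∀ j → pos g ℤ.* x j ≡ x (prev j) ℤ.+ l (prev j)
  step-cyclic zero = close
  step-cyclic (suc j) = step j
  digit : ∀ j → Σ Bool λ b → l j ≡ pos (bit b * m)
  digit j with digits j
  ... | inj₁ l≡0 = false , l≡0
  ... | inj₂ l≡m = true , trans l≡m (cong pos (sym (*-identityˡ m)))
  bits : Fin (suc n) → Bool
  bits = proj₁ ∘ digit
  lℕ : Fin (suc n) → ℕ
  lℕ j = bit (bits j) * m
  least = minimal-index x
  j₀ = proj₁ least
  least-nonneg : pos 0 ℤ.≤ x j₀
  least-nonneg = nonneg-if-below-multiple 2≤g (x j₀) (begin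
    x j₀                          ≤⟨ proj₂ least p ⟩
    x p                           ≤⟨ ℤ.i≤i+j (x p) (pos (lℕ p)) ⟩
    x p ℤ.+ pos (lℕ p)            ≡⟨ cong (λ v → x p ℤ.+ v) (sym (proj₂ (digit p))) ⟩
    x p ℤ.+ l p                   ≡⟨ sym (step-cyclic j₀) ⟩
    pos g ℤ.* x j₀                ∎)
    where
    open ℤ.≤-Reasoning
    p = prev j₀
  xℕ : Fin (suc n) → ℕ
  xℕ j = ℤ.∣ x j ∣
  xℕ-pos : ∀ j → pos (xℕ j) ≡ x j
  xℕ-pos j = ℤ.0≤i⇒+∣i∣≡i (ℤ.≤-trans least-nonneg (proj₂ least j))
  stepℕ : ∀ j → pos (g * xℕ j) ≡ pos (xℕ (prev j) + lℕ (prev j))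
  stepℕ j = begin
    pos (g * xℕ j)                   ≡⟨ ℤ.pos-* g (xℕ j) ⟩
    pos g ℤ.* pos (xℕ j)             ≡⟨ cong (λ v → pos g ℤ.* v) (xℕ-pos j) ⟩
    pos g ℤ.* x j                    ≡⟨ step-cyclic j ⟩
    x (prev j) ℤ.+ l (prev j)        ≡⟨ cong₂ ℤ._+_ (sym (xℕ-pos (prev j))) (proj₂ (digit (prev j))) ⟩
    pos (xℕ (prev j)) ℤ.+ pos (lℕ (prev j)) ≡⟨ sym (ℤ.pos-+ (xℕ (prev j)) (lℕ (prev j))) ⟩
    pos (xℕ (prev j) + lℕ (prev j))  ∎
    where open ≡-Reasoning

digit-≤ : ∀ b m → bit b * m ≤ m
digit-≤ false m = z≤n
digit-≤ true m = ≤-reflexive (*-identityˡ m)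

module CycleFacts {D m n : ℕ} (2≤D : 2 ≤ D) (C : Cycle (suc D) m n) where
  open Cycle C

  weight total : ℕ
  weight = sum (bit ∘ d)
  total = sum x

  -- The largest element x_s satisfies (D + 1)·x_s ≤ x_s + m; hence D·x_i ≤ m for all i.
  bounded : ∀ i → D * x i ≤ m
  bounded i = ≤-trans (*-monoʳ-≤ D (proj₂ top i)) top-bounded
    where
    open ≤-Reasoning
    top = maximal-index x
    s = proj₁ top
    top-bounded : D * x s ≤ m
    top-bounded = +-cancelˡ-≤ (x s) _ _ (begin
      suc D * x s                       ≡⟨ step s ⟩
      x (prev s) + bit (d (prev s)) * m ≤⟨ +-mono-≤ (proj₂ top (prev s)) (digit-≤ (d (prev s)) m) ⟩
      x s + m                           ∎)

  modulus-≥ : D ≤ m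
  modulus-≥ = ≤-trans (m≤m*n D (x j) {{ℕ.≢-nonZero xj≢0}}) (bounded j)
    where
    j = proj₁ nonzero
    xj≢0 = proj₂ nonzero

  -- All elements lie below m, since 2·x_i ≤ D·x_i ≤ m and m ≥ D > 0.
  below-modulus : ∀ i → x i < m
  below-modulus i with x i in xi
  ... | zero = ≤-trans (s≤s z≤n) (≤-trans 2≤D modulus-≥)
  ... | suc k = begin-strict
    suc k             <⟨ m<m+n (suc k) (s≤s z≤n) ⟩
    suc k + suc k     ≤⟨ +-monoʳ-≤ (suc k) (m≤m+n (suc k) _) ⟩
    2 * suc k         ≤⟨ *-monoˡ-≤ (suc k) 2≤D ⟩
    D * suc k         ≡⟨ cong (D *_) (sym xi) ⟩
    D * x i           ≤⟨ bounded i ⟩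
    m                 ∎
    where open ≤-Reasoning

  -- Summing the cycle relation over all j (the x_{prev j} run through all x): D·S = W·m.
  weight-equation : D * total ≡ weight * m
  weight-equation = +-cancelˡ-≡ total _ _ (begin
    suc D * sum x                                     ≡⟨ *-distribˡ-sum (suc D) x ⟩
    sum (λ j → suc D * x j)                           ≡⟨ sum-cong-≗ step ⟩
    sum (λ j → x (prev j) + bit (d (prev j)) * m)     ≡⟨ ∑-distrib-+ (x ∘ prev) (λ j → bit (d (prev j)) * m) ⟩
    sum (x ∘ prev) + sum (λ j → bit (d (prev j)) * m) ≡⟨ cong₂ _+_ (sum-prev x) (sum-prev (λ j → bit (d j) * m)) ⟩
    total + sum (λ j → bit (d j) * m)                 ≡⟨ cong (total +_) (sym (*-distribʳ-sum m (bit ∘ d))) ⟩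
    total + weight * m                                ∎)
    where open ≡-Reasoning

  D∣weight*m : D ∣ weight * m
  D∣weight*m = divides total (trans (sym weight-equation) (*-comm D total))

  -- Some digit equals m: otherwise D·S = 0, so all elements would vanish.
  weight-pos : 1 ≤ weight
  weight-pos with weight in w
  ... | suc _ = s≤s z≤n
  ... | zero = contradiction (n≤0⇒n≡0 (≤-trans (term-≤-sum x j) (≤-reflexive total≡0))) (proj₂ nonzero)
    where
    j = proj₁ nonzero
    total≡0 : total ≡ 0
    total≡0 with m*n≡0⇒m≡0∨n≡0 D (trans weight-equation (cong (_* m) w))
    ... | inj₁ D≡0 = contradiction (subst (2 ≤_) D≡0 2≤D) λ ()
    ... | inj₂ S≡0 = S≡0

  weight-≤ : weight ≤ suc n
  weight-≤ = begin
    sum (bit ∘ d)         ≤⟨ sum-mono (bit ∘ d) (λ _ → 1) (λ j → bit-≤1 (d j)) ⟩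
    sum {suc n} (λ _ → 1) ≡⟨ trans (sum-const (suc n) 1) (*-identityʳ (suc n)) ⟩
    suc n                 ∎
    where
    open ≤-Reasoning
    bit-≤1 : ∀ b → bit b ≤ 1
    bit-≤1 false = z≤n
    bit-≤1 true = ≤-refl

  -- If every digit equals m then every D·x_j equals m, so all elements coincide
  -- and, being distinct, there is only one of them.
  weight-full : weight ≡ suc n → n ≡ 0
  weight-full w = trans (sym (toℕ-fromℕ n)) (cong toℕ (distinct (*-cancelˡ-≡ _ _ D all-equal)))
    where
    instance
      D≢0 : NonZero D
      D≢0 = ℕ.>-nonZero (≤-trans (s≤s z≤n) 2≤D)
    sums : sum (λ j → D * x j) ≡ sum {suc n} (λ _ → m)
    sums = begin
      sum (λ j → D * x j) ≡⟨ sym (*-distribˡ-sum D x) ⟩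
      D * total           ≡⟨ weight-equation ⟩
      weight * m          ≡⟨ cong (_* m) w ⟩
      suc n * m           ≡⟨ sym (sum-const (suc n) m) ⟩
      sum {suc n} (λ _ → m) ∎
      where open ≡-Reasoning
    each : ∀ j → D * x j ≡ m
    each = sum-mono-equal (λ j → D * x j) (λ _ → m) bounded sums
    all-equal : D * x (fromℕ n) ≡ D * x zero
    all-equal = trans (each (fromℕ n)) (sym (each zero))

  trail : (t : ℕ) → Fin (suc n) → Vec Bool t
  trail zero j = []
  trail (suc t) j = d (prev^ (suc t) j) ∷ trail t j

  unroll : ∀ t j → suc D ^ t * x j ≡ x (prev^ t j) + val (suc D) (trail t j) * m
  unroll zero j = refl
  unroll (suc t) j = begin
    g * g ^ t * x j                ≡⟨ *-assoc g (g ^ t) (x j) ⟩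
    g * (g ^ t * x j)              ≡⟨ cong (g *_) (unroll t j) ⟩
    g * (x p + V * m)              ≡⟨ *-distribˡ-+ g (x p) (V * m) ⟩
    g * x p + g * (V * m)          ≡⟨ cong (_+ g * (V * m)) (step p) ⟩
    x (prev p) + b * m + g * (V * m) ≡⟨ ring (x (prev p)) b g V m ⟩
    x (prev p) + (b + g * V) * m   ∎
    where
    open ≡-Reasoning
    g = suc D
    p = prev^ t j
    V = val g (trail t j)
    b = bit (d (prev p))
    ring : ∀ a b g V m → a + b * m + g * (V * m) ≡ a + (b + g * V) * m
    ring = solve-∀

  -- If m ∣ g^k - 1 then walking k steps backwards from zero returns to zero:
  -- both ends are residues below m that agree modulo m.
  periodic : ∀ k → m ∣ suc D ^ k ∸ 1 → prev^ k zero ≡ zero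
  periodic k (divides c g^k∸1≡cm) =
    distinct (sym (same-residue (c * x zero) V (below-modulus zero) (below-modulus p) congruent))
    where
    open ≡-Reasoning
    p = prev^ k zero
    V = val (suc D) (trail k zero)
    ring : ∀ a c m → a + c * a * m ≡ suc (c * m) * a
    ring = solve-∀
    congruent : x zero + c * x zero * m ≡ x p + V * m
    congruent = begin
      x zero + c * x zero * m     ≡⟨ ring (x zero) c m ⟩
      suc (c * m) * x zero        ≡⟨ cong (_* x zero) (sym (unpred (m^n>0 (suc D) k) g^k∸1≡cm)) ⟩
      suc D ^ k * x zero          ≡⟨ unroll k zero ⟩
      x p + V * m                 ∎

  length-≤ : ∀ k → 1 ≤ k → m ∣ suc D ^ k ∸ 1 → suc n ≤ k
  length-≤ k 1≤k m∣ = first-return k 1≤k (periodic k m∣)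

  -- Hence also fewer than k digits equal m (a cycle of full weight has length 1).
  weight-< : ∀ k → 2 ≤ k → m ∣ suc D ^ k ∸ 1 → weight < k
  weight-< k 2≤k m∣ with m≤n⇒m<n∨m≡n weight-≤
  ... | inj₁ w<r = <-≤-trans w<r (length-≤ k (≤-trans (s≤s z≤n) 2≤k) m∣)
  ... | inj₂ w≡r = subst (_< k) (sym (trans w≡r (cong suc (weight-full w≡r)))) 2≤k

  -- Unrolling once around the cycle: if g^(n+1) - 1 = q·m then q·x_0 is the
  -- value of the digit word, which is therefore a multiple of q.
  turn-divides : ∀ {q} → suc D ^ suc n ∸ 1 ≡ q * m → q ∣ val (suc D) (trail (suc n) zero)
  turn-divides {q} g^r∸1≡qm = divides (x zero) (*-cancelʳ-≡ _ _ m (+-cancelˡ-≡ (x zero) _ _ (begin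
    x zero + V * m                 ≡⟨ cong (λ i → x i + V * m) (sym full-turn) ⟩
    x (prev^ (suc n) zero) + V * m ≡⟨ sym (unroll (suc n) zero) ⟩
    suc D ^ suc n * x zero         ≡⟨ cong (_* x zero) (unpred (m^n>0 (suc D) (suc n)) g^r∸1≡qm) ⟩
    suc (q * m) * x zero           ≡⟨ ring (x zero) q m ⟩
    x zero + x zero * q * m        ∎)))
    where
    open ≡-Reasoning
    V = val (suc D) (trail (suc n) zero)
    instance
      m≢0 : NonZero m
      m≢0 = ℕ.>-nonZero (≤-trans (s≤s z≤n) (≤-trans 2≤D modulus-≥))
    ring : ∀ a q m → suc (q * m) * a ≡ a + a * q * m
    ring = solve-∀

  weight-three-long : weight ≡ 3 → 3 ≤ n
  weight-three-long w with m≤n⇒m<n∨m≡n (ℕ.s≤s⁻¹ (subst (_≤ suc n) w weight-≤))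
  ... | inj₁ 2<n = 2<n
  ... | inj₂ 2≡n = contradiction (trans 2≡n (weight-full (trans w (cong suc 2≡n)))) λ ()

geom : ℕ → ℕ → ℕ
geom g zero = 0
geom g (suc k) = 1 + g * geom g k

power-pred : ∀ D k → suc D ^ k ∸ 1 ≡ D * geom (suc D) k
power-pred D k = cong (_∸ 1) (geom-identity k)
  where
  geom-identity : ∀ k → suc D ^ k ≡ suc (D * geom (suc D) k)
  geom-identity zero = cong suc (sym (*-zeroʳ D))
  geom-identity (suc k) = begin
    suc D * suc D ^ k           ≡⟨ cong (suc D *_) (geom-identity k) ⟩
    suc D * suc (D * G)         ≡⟨ ring D G ⟩
    suc (D * (1 + suc D * G))   ∎
    where
    open ≡-Reasoning
    G = geom (suc D) k
    ring : ∀ D G → suc D * suc (D * G) ≡ suc (D * (1 + suc D * G))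
    ring = solve-∀

geom-mono : ∀ B {j k} → 1 ≤ B → j ≤ k → geom B j ≤ geom B k
geom-mono B {k = zero} _ z≤n = ≤-refl
geom-mono B {j} {suc k} 1≤B j≤1+k with m≤n⇒m<n∨m≡n j≤1+k
... | inj₂ refl = ≤-refl
... | inj₁ j<1+k = begin
  geom B j           ≤⟨ geom-mono B 1≤B (ℕ.s≤s⁻¹ j<1+k) ⟩
  geom B k           ≤⟨ m≤n*m (geom B k) B {{ℕ.>-nonZero 1≤B}} ⟩
  B * geom B k       ≤⟨ n≤1+n _ ⟩
  1 + B * geom B k   ∎
  where open ≤-Reasoning

geom-triples : ∀ B k → 3 ≤ B → 3 * geom B k < geom B (suc k)
geom-triples B k 3≤B = s≤s (*-monoˡ-≤ (geom B k) 3≤B)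

canonical-rotation-4 : (bs : Vec Bool 4) → ones bs ≡ 3 →
                       ∃ λ k → rotate^ k bs ≡ true ∷ true ∷ true ∷ false ∷ []
canonical-rotation-4 (true ∷ true ∷ true ∷ true ∷ []) ()
canonical-rotation-4 (true ∷ true ∷ true ∷ false ∷ []) _ = 0 , refl
canonical-rotation-4 (true ∷ true ∷ false ∷ true ∷ []) _ = 3 , refl
canonical-rotation-4 (true ∷ true ∷ false ∷ false ∷ []) ()
canonical-rotation-4 (true ∷ false ∷ true ∷ true ∷ []) _ = 2 , refl
canonical-rotation-4 (true ∷ false ∷ true ∷ false ∷ []) ()
canonical-rotation-4 (true ∷ false ∷ false ∷ true ∷ []) ()
canonical-rotation-4 (true ∷ false ∷ false ∷ false ∷ []) ()
canonical-rotation-4 (false ∷ true ∷ true ∷ true ∷ []) _ = 1 , refl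
canonical-rotation-4 (false ∷ true ∷ true ∷ false ∷ []) ()
canonical-rotation-4 (false ∷ true ∷ false ∷ true ∷ []) ()
canonical-rotation-4 (false ∷ true ∷ false ∷ false ∷ []) ()
canonical-rotation-4 (false ∷ false ∷ true ∷ true ∷ []) ()
canonical-rotation-4 (false ∷ false ∷ true ∷ false ∷ []) ()
canonical-rotation-4 (false ∷ false ∷ false ∷ true ∷ []) ()
canonical-rotation-4 (false ∷ false ∷ false ∷ false ∷ []) ()

canonical-rotation-5 : (bs : Vec Bool 5) → ones bs ≡ 3 →
                       ∃ λ k → rotate^ k bs ≡ true ∷ true ∷ true ∷ false ∷ false ∷ []
                             ⊎ rotate^ k bs ≡ true ∷ true ∷ false ∷ true ∷ false ∷ []
canonical-rotation-5 (true ∷ true ∷ true ∷ true ∷ true ∷ []) ()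
canonical-rotation-5 (true ∷ true ∷ true ∷ true ∷ false ∷ []) ()
canonical-rotation-5 (true ∷ true ∷ true ∷ false ∷ true ∷ []) ()
canonical-rotation-5 (true ∷ true ∷ true ∷ false ∷ false ∷ []) _ = 0 , inj₁ refl
canonical-rotation-5 (true ∷ true ∷ false ∷ true ∷ true ∷ []) ()
canonical-rotation-5 (true ∷ true ∷ false ∷ true ∷ false ∷ []) _ = 0 , inj₂ refl
canonical-rotation-5 (true ∷ true ∷ false ∷ false ∷ true ∷ []) _ = 4 , inj₁ refl
canonical-rotation-5 (true ∷ true ∷ false ∷ false ∷ false ∷ []) ()
canonical-rotation-5 (true ∷ false ∷ true ∷ true ∷ true ∷ []) ()
canonical-rotation-5 (true ∷ false ∷ true ∷ true ∷ false ∷ []) _ = 2 , inj₂ refl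
canonical-rotation-5 (true ∷ false ∷ true ∷ false ∷ true ∷ []) _ = 4 , inj₂ refl
canonical-rotation-5 (true ∷ false ∷ true ∷ false ∷ false ∷ []) ()
canonical-rotation-5 (true ∷ false ∷ false ∷ true ∷ true ∷ []) _ = 3 , inj₁ refl
canonical-rotation-5 (true ∷ false ∷ false ∷ true ∷ false ∷ []) ()
canonical-rotation-5 (true ∷ false ∷ false ∷ false ∷ true ∷ []) ()
canonical-rotation-5 (true ∷ false ∷ false ∷ false ∷ false ∷ []) ()
canonical-rotation-5 (false ∷ true ∷ true ∷ true ∷ true ∷ []) ()
canonical-rotation-5 (false ∷ true ∷ true ∷ true ∷ false ∷ []) _ = 1 , inj₁ refl
canonical-rotation-5 (false ∷ true ∷ true ∷ false ∷ true ∷ []) _ = 1 , inj₂ refl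
canonical-rotation-5 (false ∷ true ∷ true ∷ false ∷ false ∷ []) ()
canonical-rotation-5 (false ∷ true ∷ false ∷ true ∷ true ∷ []) _ = 3 , inj₂ refl
canonical-rotation-5 (false ∷ true ∷ false ∷ true ∷ false ∷ []) ()
canonical-rotation-5 (false ∷ true ∷ false ∷ false ∷ true ∷ []) ()
canonical-rotation-5 (false ∷ true ∷ false ∷ false ∷ false ∷ []) ()
canonical-rotation-5 (false ∷ false ∷ true ∷ true ∷ true ∷ []) _ = 2 , inj₁ refl
canonical-rotation-5 (false ∷ false ∷ true ∷ true ∷ false ∷ []) ()
canonical-rotation-5 (false ∷ false ∷ true ∷ false ∷ true ∷ []) ()
canonical-rotation-5 (false ∷ false ∷ true ∷ false ∷ false ∷ []) ()
canonical-rotation-5 (false ∷ false ∷ false ∷ true ∷ true ∷ []) ()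
canonical-rotation-5 (false ∷ false ∷ false ∷ true ∷ false ∷ []) ()
canonical-rotation-5 (false ∷ false ∷ false ∷ false ∷ true ∷ []) ()
canonical-rotation-5 (false ∷ false ∷ false ∷ false ∷ false ∷ []) ()

-- The three canonical weight-3 patterns: if q divides g^r - 1 and the value of
-- the pattern, then q ∣ 3.  Here g = H + 1 and each step removes a multiple of q.

pattern-1110 : ∀ H {q} → q ∣ H * geom (suc H) 4 →
               q ∣ val (suc H) (true ∷ true ∷ true ∷ false ∷ []) → q ∣ 3
pattern-1110 H {q} q∣P q∣V = ∣-rest (ring₂ H) q∣V (∣n⇒∣m*n (H + 3) q∣H)
  where
  ring₁ : ∀ H → H * (1 + suc H * (1 + suc H * (1 + suc H * (1 + suc H * 0))))
              ≡ H * suc H * (1 + suc H * (1 + suc H * (1 + suc H * (0 + suc H * 0)))) + H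
  ring₁ = solve-∀
  ring₂ : ∀ H → 1 + suc H * (1 + suc H * (1 + suc H * (0 + suc H * 0))) ≡ (H + 3) * H + 3
  ring₂ = solve-∀
  q∣H : q ∣ H
  q∣H = ∣-rest (ring₁ H) q∣P (∣n⇒∣m*n (H * suc H) q∣V)

pattern-11100 : ∀ H {q} → q ∣ H * geom (suc H) 5 →
                q ∣ val (suc H) (true ∷ true ∷ true ∷ false ∷ false ∷ []) → q ∣ 3
pattern-11100 H {q} q∣P q∣V = ∣-rest refl q∣H+3 q∣H
  where
  ring₁ : ∀ H → H * (1 + suc H * (1 + suc H * (1 + suc H * (1 + suc H * (1 + suc H * 0)))))
              ≡ suc H * suc H * H * (1 + suc H * (1 + suc H * (1 + suc H * (0 + suc H * (0 + suc H * 0)))))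
                + H * (H + 2)
  ring₁ = solve-∀
  ring₂ : ∀ H → 1 + suc H * (1 + suc H * (1 + suc H * (0 + suc H * (0 + suc H * 0))))
              ≡ H * (H + 2) + (H + 3)
  ring₂ = solve-∀
  ring₃ : ∀ H → (H + 3) * H ≡ H * (H + 2) + H
  ring₃ = solve-∀
  q∣H[H+2] : q ∣ H * (H + 2)
  q∣H[H+2] = ∣-rest (ring₁ H) q∣P (∣n⇒∣m*n (suc H * suc H * H) q∣V)
  q∣H+3 : q ∣ H + 3
  q∣H+3 = ∣-rest (ring₂ H) q∣V q∣H[H+2]
  q∣H : q ∣ H
  q∣H = ∣-rest (ring₃ H) (∣m⇒∣m*n H q∣H+3) q∣H[H+2]

pattern-11010 : ∀ H {q} → q ∣ H * geom (suc H) 5 →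
                q ∣ val (suc H) (true ∷ true ∷ false ∷ true ∷ false ∷ []) → q ∣ 3
pattern-11010 H {q} q∣P q∣V = ∣-rest (ring₃ H) q∣V (∣n⇒∣m*n (suc H * suc H + suc H + 2) q∣H)
  where
  ring₁ : ∀ H → H * (H + 2) * (1 + suc H * (1 + suc H * (0 + suc H * (1 + suc H * (0 + suc H * 0)))))
              ≡ H * (1 + suc H * (1 + suc H * (1 + suc H * (1 + suc H * (1 + suc H * 0))))) + suc H * H
  ring₁ = solve-∀
  ring₂ : ∀ H → H * (1 + suc H * (1 + suc H * (1 + suc H * (1 + suc H * (1 + suc H * 0)))))
              ≡ suc H * H * (1 + suc H + suc H * suc H + suc H * suc H * suc H) + H
  ring₂ = solve-∀
  ring₃ : ∀ H → 1 + suc H * (1 + suc H * (0 + suc H * (1 + suc H * (0 + suc H * 0))))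
              ≡ (suc H * suc H + suc H + 2) * H + 3
  ring₃ = solve-∀
  q∣gH : q ∣ suc H * H
  q∣gH = ∣-rest (ring₁ H) (∣n⇒∣m*n (H * (H + 2)) q∣V) q∣P
  q∣H : q ∣ H
  q∣H = ∣-rest (ring₂ H) q∣P (∣m⇒∣m*n _ q∣gH)

-- A divisor q of g^r - 1 (r = 4, 5) that divides the value of a weight-3 word
-- of length r divides 3: rotate the word to a canonical pattern.
weight-three-4 : ∀ H {q} → q ∣ suc H ^ 4 ∸ 1 → (bs : Vec Bool 4) → ones bs ≡ 3 →
                 q ∣ val (suc H) bs → q ∣ 3
weight-three-4 H {q} q∣P bs three q∣V with canonical-rotation-4 bs three
... | k , e = pattern-1110 H (subst (q ∣_) (power-pred H 4) q∣P) (rotate^-∣ (s≤s z≤n) q∣P k e q∣V)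

weight-three-5 : ∀ H {q} → q ∣ suc H ^ 5 ∸ 1 → (bs : Vec Bool 5) → ones bs ≡ 3 →
                 q ∣ val (suc H) bs → q ∣ 3
weight-three-5 H {q} q∣P bs three q∣V with canonical-rotation-5 bs three
... | k , inj₁ e = pattern-11100 H q∣H·G (rotate^-∣ (s≤s z≤n) q∣P k e q∣V)
  where q∣H·G = subst (q ∣_) (power-pred H 5) q∣P
... | k , inj₂ e = pattern-11010 H q∣H·G (rotate^-∣ (s≤s z≤n) q∣P k e q∣V)
  where q∣H·G = subst (q ∣_) (power-pred H 5) q∣P

-- Explicit cycles for the moduli (g^4 - 1)/3 and (g^5 - 1)/3 when g = 3t + 1.
-- Their distinctness comes from listing the elements in increasing order.

-- A function on Fin (suc n) increasing along consecutive indices is injective: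
-- its first value lies below all later ones.
increasing⇒injective : ∀ {n} (f : Fin (suc n) → ℕ) → (∀ i → f (inject₁ i) < f (suc i)) →
                       Injective _≡_ _≡_ f
increasing⇒injective f inc {zero} {zero} _ = refl
increasing⇒injective f inc {zero} {suc j} e = contradiction e (<⇒≢ (head-least f inc j))
  where
  head-least : ∀ {n} (f : Fin (suc n) → ℕ) → (∀ i → f (inject₁ i) < f (suc i)) →
               ∀ j → f zero < f (suc j)
  head-least f inc zero = inc zero
  head-least f inc (suc j) = <-trans (inc zero) (head-least (f ∘ suc) (inc ∘ suc) j)
increasing⇒injective f inc {suc i} {zero} e = sym (increasing⇒injective f inc (sym e))
increasing⇒injective {suc n} f inc {suc i} {suc j} e =
  cong suc (increasing⇒injective (f ∘ suc) (inc ∘ suc) e)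

consecutive : ∀ {n} (f : ℕ → Fin (suc n) → ℕ) (i : Fin n) {c : ℕ → ℕ} →
              (∀ b → f (suc b) (suc i) ≡ suc (f (suc b) (inject₁ i) + c b)) →
              ∀ t → 1 ≤ t → f t (inject₁ i) < f t (suc i)
consecutive f i {c} gap (suc b) _ =
  subst (f (suc b) (inject₁ i) <_) (sym (gap b)) (s≤s (m≤m+n _ (c b)))

elements-4 : ℕ → Fin 4 → ℕ
elements-4 t zero                   = 1 + 3 * t + 3 * t * t
elements-4 t (suc zero)             = 1 + 4 * t + 9 * t * t + 9 * t * t * t
elements-4 t (suc (suc zero))       = 1 + 5 * t + 12 * t * t + 9 * t * t * t
elements-4 t (suc (suc (suc zero))) = 1 + 6 * t + 12 * t * t + 9 * t * t * t

elements-4-increasing : ∀ t → 1 ≤ t → ∀ i → elements-4 t (inject₁ i) < elements-4 t (suc i)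
elements-4-increasing t 1≤t zero = consecutive elements-4 zero gap t 1≤t
  where
  gap : ∀ b → 1 + 4 * suc b + 9 * suc b * suc b + 9 * suc b * suc b * suc b
            ≡ suc (1 + 3 * suc b + 3 * suc b * suc b + (15 + 40 * b + 33 * b * b + 9 * b * b * b))
  gap = solve-∀
elements-4-increasing t 1≤t (suc zero) = consecutive elements-4 (suc zero) gap t 1≤t
  where
  gap : ∀ b → 1 + 5 * suc b + 12 * suc b * suc b + 9 * suc b * suc b * suc b
            ≡ suc (1 + 4 * suc b + 9 * suc b * suc b + 9 * suc b * suc b * suc b + (3 + 7 * b + 3 * b * b))
  gap = solve-∀
elements-4-increasing t 1≤t (suc (suc zero)) = consecutive elements-4 (suc (suc zero)) gap t 1≤t
  where
  gap : ∀ b → 1 + 6 * suc b + 12 * suc b * suc b + 9 * suc b * suc b * suc b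
            ≡ suc (1 + 5 * suc b + 12 * suc b * suc b + 9 * suc b * suc b * suc b + b)
  gap = solve-∀

sorted-5 : ℕ → Fin 5 → ℕ
sorted-5 t zero                         = 1 + 3 * t + 3 * t * t
sorted-5 t (suc zero)                   = 1 + 6 * t + 12 * t * t + 9 * t * t * t
sorted-5 t (suc (suc zero))             = 1 + 5 * t + 18 * t * t + 36 * t * t * t + 27 * t * t * t * t
sorted-5 t (suc (suc (suc zero)))       = 1 + 7 * t + 27 * t * t + 45 * t * t * t + 27 * t * t * t * t
sorted-5 t (suc (suc (suc (suc zero)))) = 1 + 9 * t + 30 * t * t + 45 * t * t * t + 27 * t * t * t * t

sorted-5-increasing : ∀ t → 1 ≤ t → ∀ i → sorted-5 t (inject₁ i) < sorted-5 t (suc i)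
sorted-5-increasing t 1≤t zero = consecutive sorted-5 zero gap t 1≤t
  where
  gap : ∀ b → 1 + 6 * suc b + 12 * suc b * suc b + 9 * suc b * suc b * suc b
            ≡ suc (1 + 3 * suc b + 3 * suc b * suc b + (20 + 48 * b + 36 * b * b + 9 * b * b * b))
  gap = solve-∀
sorted-5-increasing t 1≤t (suc zero) = consecutive sorted-5 (suc zero) gap t 1≤t
  where
  gap : ∀ b → 1 + 5 * suc b + 18 * suc b * suc b + 36 * suc b * suc b * suc b + 27 * suc b * suc b * suc b * suc b
            ≡ suc (1 + 6 * suc b + 12 * suc b * suc b + 9 * suc b * suc b * suc b
                 + (58 + 200 * b + 249 * b * b + 135 * b * b * b + 27 * b * b * b * b))
  gap = solve-∀
sorted-5-increasing t 1≤t (suc (suc zero)) = consecutive sorted-5 (suc (suc zero)) gap t 1≤t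
  where
  gap : ∀ b → 1 + 7 * suc b + 27 * suc b * suc b + 45 * suc b * suc b * suc b + 27 * suc b * suc b * suc b * suc b
            ≡ suc (1 + 5 * suc b + 18 * suc b * suc b + 36 * suc b * suc b * suc b + 27 * suc b * suc b * suc b * suc b
                 + (19 + 47 * b + 36 * b * b + 9 * b * b * b))
  gap = solve-∀
sorted-5-increasing t 1≤t (suc (suc (suc zero))) = consecutive sorted-5 (suc (suc (suc zero))) gap t 1≤t
  where
  gap : ∀ b → 1 + 9 * suc b + 30 * suc b * suc b + 45 * suc b * suc b * suc b + 27 * suc b * suc b * suc b * suc b
            ≡ suc (1 + 7 * suc b + 27 * suc b * suc b + 45 * suc b * suc b * suc b + 27 * suc b * suc b * suc b * suc b
                 + (4 + 8 * b + 3 * b * b))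
  gap = solve-∀

-- Position of each element of the length-5 cycle in increasing order: x₀ < x₄ < x₁ < x₂ < x₃.
rank rank⁻¹ : Fin 5 → Fin 5
rank zero = zero
rank (suc zero) = suc (suc zero)
rank (suc (suc zero)) = suc (suc (suc zero))
rank (suc (suc (suc zero))) = suc (suc (suc (suc zero)))
rank (suc (suc (suc (suc zero)))) = suc zero
rank⁻¹ zero = zero
rank⁻¹ (suc zero) = suc (suc (suc (suc zero)))
rank⁻¹ (suc (suc zero)) = suc zero
rank⁻¹ (suc (suc (suc zero))) = suc (suc zero)
rank⁻¹ (suc (suc (suc (suc zero)))) = suc (suc (suc zero))

rank-injective : Injective _≡_ _≡_ rank
rank-injective {i} {j} e = trans (sym (inverse i)) (trans (cong rank⁻¹ e) (inverse j))
  where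
  inverse : ∀ j → rank⁻¹ (rank j) ≡ j
  inverse zero = refl
  inverse (suc zero) = refl
  inverse (suc (suc zero)) = refl
  inverse (suc (suc (suc zero))) = refl
  inverse (suc (suc (suc (suc zero)))) = refl

-- Explicit cycles in base g = 3t + 1 (t ≥ 1) for the moduli
-- M₄ = (g⁴ - 1)/3 with digits (M, M, M, 0) and M₅ = (g⁵ - 1)/3 with digits (M, M, M, 0, 0).
module ExplicitCycles (t : ℕ) (1≤t : 1 ≤ t) where
  M₄ M₅ : ℕ
  M₄ = 4 * t + 18 * t * t + 36 * t * t * t + 27 * t * t * t * t
  M₅ = 5 * t + 30 * t * t + 90 * t * t * t + 135 * t * t * t * t + 81 * t * t * t * t * t

  M₄-geom : M₄ ≡ t * geom (suc (t * 3)) 4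
  M₄-geom = ring t
    where
    ring : ∀ t → 4 * t + 18 * t * t + 36 * t * t * t + 27 * t * t * t * t
               ≡ t * (1 + suc (t * 3) * (1 + suc (t * 3) * (1 + suc (t * 3) * (1 + suc (t * 3) * 0))))
    ring = solve-∀

  M₅-geom : M₅ ≡ t * geom (suc (t * 3)) 5
  M₅-geom = ring t
    where
    ring : ∀ t → 5 * t + 30 * t * t + 90 * t * t * t + 135 * t * t * t * t + 81 * t * t * t * t * t
               ≡ t * (1 + suc (t * 3) * (1 + suc (t * 3) * (1 + suc (t * 3)
                   * (1 + suc (t * 3) * (1 + suc (t * 3) * 0)))))
    ring = solve-∀

  cycle-4 : Cycle (suc (t * 3)) M₄ 3
  cycle-4 = record
    { x = elements-4 t
    ; d = d
    ; distinct = increasing⇒injective (elements-4 t) (elements-4-increasing t 1≤t)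
    ; step = step
    ; nonzero = zero , λ ()
    }
    where
    d : Fin 4 → Bool
    d (suc (suc (suc zero))) = false
    d _ = true
    step : ∀ j → suc (t * 3) * elements-4 t j ≡ elements-4 t (prev j) + bit (d (prev j)) * M₄
    step zero = ring₀ t
      where
      ring₀ : ∀ t → suc (t * 3) * (1 + 3 * t + 3 * t * t) ≡ 1 + 6 * t + 12 * t * t + 9 * t * t * t + 0
      ring₀ = solve-∀
    step (suc zero) = ring₁ t
      where
      ring₁ : ∀ t → suc (t * 3) * (1 + 4 * t + 9 * t * t + 9 * t * t * t)
                  ≡ 1 + 3 * t + 3 * t * t
                    + 1 * (4 * t + 18 * t * t + 36 * t * t * t + 27 * t * t * t * t)
      ring₁ = solve-∀
    step (suc (suc zero)) = ring₂ t
      where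
      ring₂ : ∀ t → suc (t * 3) * (1 + 5 * t + 12 * t * t + 9 * t * t * t)
                  ≡ 1 + 4 * t + 9 * t * t + 9 * t * t * t
                    + 1 * (4 * t + 18 * t * t + 36 * t * t * t + 27 * t * t * t * t)
      ring₂ = solve-∀
    step (suc (suc (suc zero))) = ring₃ t
      where
      ring₃ : ∀ t → suc (t * 3) * (1 + 6 * t + 12 * t * t + 9 * t * t * t)
                  ≡ 1 + 5 * t + 12 * t * t + 9 * t * t * t
                    + 1 * (4 * t + 18 * t * t + 36 * t * t * t + 27 * t * t * t * t)
      ring₃ = solve-∀

  cycle-5 : Cycle (suc (t * 3)) M₅ 4
  cycle-5 = record
    { x = sorted-5 t ∘ rank
    ; d = d
    ; distinct = rank-injective ∘ increasing⇒injective (sorted-5 t) (sorted-5-increasing t 1≤t)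
    ; step = step
    ; nonzero = zero , λ ()
    }
    where
    d : Fin 5 → Bool
    d (suc (suc (suc zero))) = false
    d (suc (suc (suc (suc zero)))) = false
    d _ = true
    step : ∀ j → suc (t * 3) * sorted-5 t (rank j) ≡ sorted-5 t (rank (prev j)) + bit (d (prev j)) * M₅
    step zero = ring₀ t
      where
      ring₀ : ∀ t → suc (t * 3) * (1 + 3 * t + 3 * t * t) ≡ 1 + 6 * t + 12 * t * t + 9 * t * t * t + 0
      ring₀ = solve-∀
    step (suc zero) = ring₁ t
      where
      ring₁ : ∀ t → suc (t * 3) * (1 + 5 * t + 18 * t * t + 36 * t * t * t + 27 * t * t * t * t)
                  ≡ 1 + 3 * t + 3 * t * t
                    + 1 * (5 * t + 30 * t * t + 90 * t * t * t + 135 * t * t * t * t + 81 * t * t * t * t * t)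
      ring₁ = solve-∀
    step (suc (suc zero)) = ring₂ t
      where
      ring₂ : ∀ t → suc (t * 3) * (1 + 7 * t + 27 * t * t + 45 * t * t * t + 27 * t * t * t * t)
                  ≡ 1 + 5 * t + 18 * t * t + 36 * t * t * t + 27 * t * t * t * t
                    + 1 * (5 * t + 30 * t * t + 90 * t * t * t + 135 * t * t * t * t + 81 * t * t * t * t * t)
      ring₂ = solve-∀
    step (suc (suc (suc zero))) = ring₃ t
      where
      ring₃ : ∀ t → suc (t * 3) * (1 + 9 * t + 30 * t * t + 45 * t * t * t + 27 * t * t * t * t)
                  ≡ 1 + 7 * t + 27 * t * t + 45 * t * t * t + 27 * t * t * t * t
                    + 1 * (5 * t + 30 * t * t + 90 * t * t * t + 135 * t * t * t * t + 81 * t * t * t * t * t)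
      ring₃ = solve-∀
    step (suc (suc (suc (suc zero)))) = ring₄ t
      where
      ring₄ : ∀ t → suc (t * 3) * (1 + 6 * t + 12 * t * t + 9 * t * t * t)
                  ≡ 1 + 9 * t + 30 * t * t + 45 * t * t * t + 27 * t * t * t * t + 0
      ring₄ = solve-∀

UniquePrimitive : ℕ → ℕ → ℕ → Set
UniquePrimitive g k M =
  (Primitive g M × IsOrder g M k) × (∀ m → Primitive g m → IsOrder g m k → m ≡ M)

module EvenBase (D : ℕ) (3≤D : 3 ≤ D) (g-even : 2 ∣ suc D) where
  g : ℕ
  g = suc D

  2≤D : 2 ≤ D
  2≤D = ≤-trans (n≤1+n 2) 3≤D

  instance
    D≢0 : NonZero D
    D≢0 = ℕ.>-nonZero (≤-trans (s≤s z≤n) 3≤D)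

  odd-D : ¬ 2 ∣ D
  odd-D 2∣D = contradiction (∣1⇒≡1 (∣-rest (+-comm 1 D) g-even 2∣D)) λ ()

  cycle-of : ∀ {m} → Incomplete g m → ∃ (Cycle g m)
  cycle-of = incomplete⇒cycle (s≤s (≤-trans (n≤1+n 1) 2≤D))

  incomplete-≥ : ∀ {m} → Incomplete g m → D ≤ m
  incomplete-≥ inc = CycleFacts.modulus-≥ 2≤D (proj₂ (cycle-of inc))

  D∣power : ∀ k → D ∣ g ^ k ∸ 1
  D∣power k = divides (geom g k) (trans (power-pred D k) (*-comm D _))

  -- D is incomplete: {1} is a cycle with digit D.
  D-incomplete : Incomplete g D
  D-incomplete = cycle⇒incomplete {n = 0} record
    { x = λ _ → 1
    ; d = λ _ → true
    ; distinct = λ { {zero} {zero} _ → refl }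
    ; step = λ { zero → cong suc (trans (*-identityʳ D) (sym (*-identityˡ D))) }
    ; nonzero = zero , λ ()
    }

  -- Proper divisors of D are smaller than D, hence complete.
  D-primitive : Primitive g D
  D-primitive = odd-D , D-incomplete , λ d d∣D d≢D inc → <⇒≱ (≤∧≢⇒< (∣⇒≤ d∣D) d≢D) (incomplete-≥ inc)

  D-order-1 : IsOrder g D 1
  D-order-1 = ≤-refl , D∣power 1 , λ j 1≤j j<1 → contradiction 1≤j (<⇒≱ j<1)

  -- A primitive number of order 1 divides D and is at least D.
  order-1-unique : ∀ m → Primitive g m → IsOrder g m 1 → m ≡ D
  order-1-unique m (_ , inc , _) (_ , m∣g-1 , _) =
    ≤-antisym (∣⇒≤ (subst (m ∣_) (*-identityʳ D) m∣g-1)) (incomplete-≥ inc)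

  -- A primitive number of order k ≥ 2 is not a multiple of D: it is not D
  -- (which has order 1), and D is not a proper divisor (D is incomplete).
  not-multiple-of-D : ∀ {m k} → Primitive g m → IsOrder g m k → 2 ≤ k → ¬ D ∣ m
  not-multiple-of-D {m} (_ , _ , proper) (_ , _ , minimal) 2≤k D∣m with D ≟ m
  ... | yes refl = minimal 1 ≤-refl 2≤k (D∣power 1)
  ... | no D≢m = proper D D∣m D≢m D-incomplete

  weight-data : ∀ {m k} → Incomplete g m → 2 ≤ k → m ∣ g ^ k ∸ 1 →
                ∃ λ w → 1 ≤ w × w < k × D ∣ w * m
  weight-data inc 2≤k m∣ = weight , weight-pos , weight-< _ 2≤k m∣ , D∣weight*m
    where open CycleFacts 2≤D (proj₂ (cycle-of inc))

  -- There is no primitive number of order 2 ≤ k ≤ 5, unless k ≥ 4 and 3 ∣ D: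
  -- w cancels from D ∣ w·m, contradicting not-multiple-of-D.
  no-primitive : ∀ k → 2 ≤ k → k ≤ 5 → k ≤ 3 ⊎ ¬ 3 ∣ D → ∀ m → Primitive g m → ¬ IsOrder g m k
  no-primitive k 2≤k k≤5 small-or-coprime m prim order =
    refute (weight-data (proj₁ (proj₂ prim)) 2≤k (proj₁ (proj₂ order)))
    where
    refute : (∃ λ w → 1 ≤ w × w < k × D ∣ w * m) → ⊥
    refute (w , 1≤w , w<k , D∣wm) =
      not-multiple-of-D prim order 2≤k (cancel-weight odd-D 1≤w w≤4 weight-three D∣wm)
      where
      w≤4 : w ≤ 4
      w≤4 = ℕ.s≤s⁻¹ (≤-trans w<k k≤5)
      weight-three : w ≡ 3 → ¬ 3 ∣ D
      weight-three w≡3 = [ too-small , id ]′ small-or-coprime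
        where
        too-small : k ≤ 3 → ¬ 3 ∣ D
        too-small k≤3 = contradiction (≤-trans (subst (_< k) w≡3 w<k) k≤3) (<-irrefl refl)

  -- A weight-3 cycle of m of length n + 1 ∈ {4, 5} that closes after k ∈ {4, 5}
  -- steps, where g^k - 1 = q·m: the cycle has length exactly k, and reading its
  -- digits around the turn shows q ∣ 3.
  full-turn-cases : ∀ {m q} n k (C : Cycle g m n) → CycleFacts.weight 2≤D C ≡ 3 →
                    n ≡ 3 ⊎ n ≡ 4 → k ≡ 4 ⊎ k ≡ 5 → g ^ k ∸ 1 ≡ q * m → q ∣ 3
  full-turn-cases {m} {q} .3 .4 C three (inj₁ refl) (inj₁ refl) e =
    weight-three-4 D (divides m (trans e (*-comm q m))) (trail 4 zero) three (turn-divides e)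
    where open CycleFacts 2≤D C
  full-turn-cases {m} {q} .4 .5 C three (inj₂ refl) (inj₂ refl) e =
    weight-three-5 D (divides m (trans e (*-comm q m))) (trail 5 zero) three (turn-divides e)
    where open CycleFacts 2≤D C
  full-turn-cases {q = q} .3 .5 C _ (inj₁ refl) (inj₂ refl) e =
    contradiction (periodic 5 (divides q e)) λ ()
    where open CycleFacts 2≤D C
  full-turn-cases {q = q} .4 .4 C _ (inj₂ refl) (inj₁ refl) e =
    contradiction (length-≤ 4 (s≤s z≤n) (divides q e)) (<-irrefl refl)
    where open CycleFacts 2≤D C

  -- For k ∈ {4, 5}: if g^k - 1 = q·m with m incomplete and not a multiple of D,
  -- then q ∣ 3.  The weight of a cycle of m is 3 (otherwise D ∣ m), so the cycle
  -- has length 4 or 5.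
  cofactor-divides-3 : ∀ {m q} k → 4 ≤ k → k ≤ 5 → Incomplete g m → g ^ k ∸ 1 ≡ q * m →
                       ¬ D ∣ m → q ∣ 3
  cofactor-divides-3 {m} {q} k 4≤k k≤5 inc e D∤m =
    full-turn-cases n k C three (one-of-two (weight-three-long three) n≤4) (one-of-two 4≤k k≤5) e
    where
    n = proj₁ (cycle-of inc)
    C = proj₂ (cycle-of inc)
    open CycleFacts 2≤D C
    m∣ : m ∣ g ^ k ∸ 1
    m∣ = divides q e
    w≤4 : weight ≤ 4
    w≤4 = ℕ.s≤s⁻¹ (≤-trans (weight-< k (≤-trans (s≤s (s≤s z≤n)) 4≤k) m∣) k≤5)
    three : weight ≡ 3
    three with weight ≟ 3
    ... | yes w≡3 = w≡3
    ... | no w≢3 =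
      contradiction (cancel-weight odd-D weight-pos w≤4 (λ w≡3 → contradiction w≡3 w≢3) D∣weight*m) D∤m
    n≤4 : n ≤ 4
    n≤4 = ℕ.s≤s⁻¹ (≤-trans (length-≤ k (≤-trans (s≤s z≤n) 4≤k) m∣) k≤5)

  -- If g^k - 1 = 3M with k ≥ 1 then M is odd, since g^k is even.
  odd-cofactor : ∀ {M} k → 1 ≤ k → g ^ k ∸ 1 ≡ 3 * M → ¬ 2 ∣ M
  odd-cofactor {M} (suc k) _ e 2∣M =
    contradiction (∣1⇒≡1 (∣-rest g^k≡3M+1 (∣m⇒∣m*n (g ^ k) g-even) (∣n⇒∣m*n 3 2∣M))) λ ()
    where
    g^k≡3M+1 : g ^ suc k ≡ 3 * M + 1
    g^k≡3M+1 = trans (unpred (m^n>0 g (suc k)) e) (+-comm 1 (3 * M))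

  -- If g^k - 1 = 3M then M does not divide g^j - 1 for 1 ≤ j < k, because
  -- 0 < g^j - 1 = D·geom j and 3·D·geom j < D·geom k = 3M.
  order-exactly : ∀ {M} k → g ^ k ∸ 1 ≡ 3 * M → ∀ j → 1 ≤ j → j < k → ¬ M ∣ g ^ j ∸ 1
  order-exactly {M} k e (suc j) _ j<k M∣ = <⇒≱ below (∣⇒≤ {{positive}} M∣)
    where
    open ≤-Reasoning
    Gⱼ = geom g (suc j)
    positive : NonZero (g ^ suc j ∸ 1)
    positive = subst NonZero (sym (power-pred D (suc j))) (ℕ.m*n≢0 D Gⱼ {{D≢0}} {{_}})
    3Gⱼ<Gₖ : 3 * Gⱼ < geom g k
    3Gⱼ<Gₖ = <-≤-trans (geom-triples g (suc j) (s≤s (≤-trans (n≤1+n 2) 3≤D))) (geom-mono g (s≤s z≤n) j<k)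
    ring : ∀ D G → 3 * (D * G) ≡ D * (3 * G)
    ring = solve-∀
    below : g ^ suc j ∸ 1 < M
    below = *-cancelˡ-< 3 _ _ (begin-strict
      3 * (g ^ suc j ∸ 1)   ≡⟨ cong (3 *_) (power-pred D (suc j)) ⟩
      3 * (D * Gⱼ)          ≡⟨ ring D Gⱼ ⟩
      D * (3 * Gⱼ)          <⟨ *-monoʳ-< D 3Gⱼ<Gₖ ⟩
      D * geom g k          ≡⟨ sym (power-pred D k) ⟩
      g ^ k ∸ 1             ≡⟨ e ⟩
      3 * M                 ∎)

  unique-primitive : ∀ {M} k → 4 ≤ k → k ≤ 5 → g ^ k ∸ 1 ≡ 3 * M → ¬ D ∣ M → Incomplete g M →
                     UniquePrimitive g k M
  unique-primitive {M} k 4≤k k≤5 e D∤M inc =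
    ((odd-cofactor k 1≤k e , inc , proper) , 1≤k , divides 3 e , order-exactly k e) , unique
    where
    1≤k : 1 ≤ k
    1≤k = ≤-trans (s≤s z≤n) 4≤k
    2≤k : 2 ≤ k
    2≤k = ≤-trans (s≤s (s≤s z≤n)) 4≤k
    -- An incomplete divisor d of M = c·d has cofactor 3c in g^k - 1, which divides 3; so c = 1.
    proper : ∀ d → d ∣ M → d ≢ M → Complete g d
    proper d (divides c M≡cd) d≢M inc-d = d≢M (begin
      d       ≡⟨ sym (*-identityˡ d) ⟩
      1 * d   ≡⟨ cong (_* d) (sym c≡1) ⟩
      c * d   ≡⟨ sym M≡cd ⟩
      M       ∎)
      where
      open ≡-Reasoning
      cofactor : g ^ k ∸ 1 ≡ 3 * c * d
      cofactor = trans e (trans (cong (3 *_) M≡cd) (sym (*-assoc 3 c d)))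
      c≡1 : c ≡ 1
      c≡1 = ∣1⇒≡1 (*-cancelˡ-∣ 3 (cofactor-divides-3 k 4≤k k≤5 inc-d cofactor
                                    (λ D∣d → D∤M (∣-trans D∣d (divides c M≡cd)))))
    -- A primitive m of order k has cofactor 1 or 3 in g^k - 1; cofactor 1 would
    -- make m = g^k - 1 a multiple of D.
    unique : ∀ m → Primitive g m → IsOrder g m k → m ≡ M
    unique m prim order@(_ , divides q e′ , _) = by-cofactor q e′
      (divisors-of-3 (cofactor-divides-3 k 4≤k k≤5 (proj₁ (proj₂ prim)) e′ D∤m))
      where
      D∤m : ¬ D ∣ m
      D∤m = not-multiple-of-D prim order 2≤k
      by-cofactor : ∀ q → g ^ k ∸ 1 ≡ q * m → q ≡ 1 ⊎ q ≡ 3 → m ≡ M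
      by-cofactor .1 e′ (inj₁ refl) =
        contradiction (subst (D ∣_) (trans e′ (*-identityˡ m)) (D∣power k)) D∤m
      by-cofactor .3 e′ (inj₂ refl) = *-cancelˡ-≡ m M 3 (trans (sym e′) e)

-- The case 3 ∣ D, D = 3t: the unique primitive numbers of orders 4 and 5 are
-- M₄ = t·geom 4 = (g⁴ - 1)/3 and M₅ = t·geom 5 = (g⁵ - 1)/3.
module MultipleOfThree (t : ℕ) (1≤t : 1 ≤ t) (g-even : 2 ∣ suc (t * 3)) where
  3≤D : 3 ≤ t * 3
  3≤D = *-monoˡ-≤ 3 1≤t

  open EvenBase (t * 3) 3≤D g-even
  open ExplicitCycles t 1≤t

  instance
    t≢0 : NonZero t
    t≢0 = ℕ.>-nonZero 1≤t

  unique-for : ∀ k {M} → 4 ≤ k → k ≤ 5 → M ≡ t * geom g k → ¬ 3 ∣ geom g k → Incomplete g M →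
               UniquePrimitive g k ((g ^ k ∸ 1) / 3)
  unique-for k {M} 4≤k k≤5 M≡tG 3∤G inc =
    subst (UniquePrimitive g k) (sym quotient) (unique-primitive k 4≤k k≤5 three-M D∤M inc)
    where
    open ≡-Reasoning
    three-M : g ^ k ∸ 1 ≡ 3 * M
    three-M = begin
      g ^ k ∸ 1              ≡⟨ power-pred (t * 3) k ⟩
      t * 3 * geom g k       ≡⟨ ring t (geom g k) ⟩
      3 * (t * geom g k)     ≡⟨ cong (3 *_) (sym M≡tG) ⟩
      3 * M                  ∎
      where
      ring : ∀ t G → t * 3 * G ≡ 3 * (t * G)
      ring = solve-∀
    quotient : (g ^ k ∸ 1) / 3 ≡ M
    quotient = trans (cong (_/ 3) (trans three-M (*-comm 3 M))) (m*n/n≡m M 3)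
    D∤M : ¬ t * 3 ∣ M
    D∤M D∣M = 3∤G (*-cancelˡ-∣ t (subst (t * 3 ∣_) M≡tG D∣M))

  -- geom 4 ≡ 4 and geom 5 ≡ 5 modulo 3, as g ≡ 1.
  order-4 : UniquePrimitive g 4 ((g ^ 4 ∸ 1) / 3)
  order-4 = unique-for 4 ≤-refl (n≤1+n 4) M₄-geom
    (not-three-divides (1 + 6 * t + 12 * t * t + 9 * t * t * t) 1 (ring t)
      λ 3∣1 → contradiction (n∣m⇒m%n≡0 1 3 3∣1) λ ())
    (cycle⇒incomplete cycle-4)
    where
    ring : ∀ t → 1 + suc (t * 3) * (1 + suc (t * 3) * (1 + suc (t * 3) * (1 + suc (t * 3) * 0)))
               ≡ 3 * (1 + 6 * t + 12 * t * t + 9 * t * t * t) + 1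
    ring = solve-∀

  order-5 : UniquePrimitive g 5 ((g ^ 5 ∸ 1) / 3)
  order-5 = unique-for 5 (n≤1+n 4) ≤-refl M₅-geom
    (not-three-divides (1 + 10 * t + 30 * t * t + 45 * t * t * t + 27 * t * t * t * t) 2 (ring t)
      λ 3∣2 → contradiction (n∣m⇒m%n≡0 2 3 3∣2) λ ())
    (cycle⇒incomplete cycle-5)
    where
    ring : ∀ t → 1 + suc (t * 3) * (1 + suc (t * 3) * (1 + suc (t * 3)
                   * (1 + suc (t * 3) * (1 + suc (t * 3) * 0))))
               ≡ 3 * (1 + 10 * t + 30 * t * t + 45 * t * t * t + 27 * t * t * t * t) + 2
    ring = solve-∀

order-four-five : ∀ D → 3 ≤ D → 2 ∣ suc D → 3 ∣ D →
                  UniquePrimitive (suc D) 4 ((suc D ^ 4 ∸ 1) / 3)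
                  × UniquePrimitive (suc D) 5 ((suc D ^ 5 ∸ 1) / 3)
order-four-five .(zero * 3) () _ (divides zero refl)
order-four-five .(suc t * 3) _ g-even (divides (suc t) refl) = order-4 , order-5
  where open MultipleOfThree (suc t) (s≤s z≤n) g-even

theorem4p1 : (g : ℕ) → 4 ≤ g → 2 ∣ g →
    ((Primitive g (g ∸ 1) × IsOrder g (g ∸ 1) 1)
      × (∀ m → Primitive g m → IsOrder g m 1 → m ≡ g ∸ 1))
    × (∀ m → Primitive g m → ¬ IsOrder g m 2)
    × (∀ m → Primitive g m → ¬ IsOrder g m 3)
    × (¬ (3 ∣ (g ∸ 1)) →
        (∀ m → Primitive g m → ¬ IsOrder g m 4)
        × (∀ m → Primitive g m → ¬ IsOrder g m 5))
    × (3 ∣ (g ∸ 1) →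
        ((Primitive g ((g ^ 4 ∸ 1) / 3) × IsOrder g ((g ^ 4 ∸ 1) / 3) 4)
          × (∀ m → Primitive g m → IsOrder g m 4 → m ≡ (g ^ 4 ∸ 1) / 3))
        × ((Primitive g ((g ^ 5 ∸ 1) / 3) × IsOrder g ((g ^ 5 ∸ 1) / 3) 5)
          × (∀ m → Primitive g m → IsOrder g m 5 → m ≡ (g ^ 5 ∸ 1) / 3)))
theorem4p1 (suc D) (s≤s 3≤D) g-even =
  ((D-primitive , D-order-1) , order-1-unique)
  , no-primitive 2 ≤-refl 2≤5 (inj₁ (n≤1+n 2))
  , no-primitive 3 (n≤1+n 2) 3≤5 (inj₁ ≤-refl)
  , (λ 3∤D → no-primitive 4 2≤4 4≤5 (inj₂ 3∤D) , no-primitive 5 2≤5 ≤-refl (inj₂ 3∤D))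
  , order-four-five D 3≤D g-even
  where
  open EvenBase D 3≤D g-even
  2≤4 : 2 ≤ 4
  2≤4 = s≤s (s≤s z≤n)
  2≤5 : 2 ≤ 5
  2≤5 = s≤s (s≤s z≤n)
  3≤5 : 3 ≤ 5
  3≤5 = s≤s (s≤s (s≤s z≤n))
  4≤5 : 4 ≤ 5
  4≤5 = n≤1+n 4
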